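{- If a permutation $\pi$ is plus-decomposable, $\pi=\sigma\oplus\rho$, then $t(\pi)=t(\sigma)+t(\rho)$.
   Context: For permutations $\sigma$ of length $a$ and $\rho$ of length $b$, $\sigma\oplus\rho$ is the permutation of length $a+b$ obtained by concatenating $\sigma$ with the sequence $\rho$ in which every entry is increased by $a$; $\pi$ is plus-decomposable if $\pi=\sigma\oplus\rho$ for nonempty $\sigma,\rho$. Multi-pass stack sorting: in a pass, the entries of the current input are pushed one at a time, in order, onto a stack; whenever the top of the stack is the smallest value not yet output, it is popped to the output (repeatedly); entries are never popped otherwise. When all input entries have been pushed and no pop is possible, if the stack is nonempty the remaining entries are returned to the input in their original relative order and a new pass begins. The tier $t(\pi)$ is one less than the minimum number of passes needed to output $1,\dots,n$. -}

module Defs where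

open import Data.Nat using (ℕ; zero; suc; _+_; _∸_)
open import Data.Nat.Properties using (_≟_)
open import Data.List using (List; []; _∷_; _++_; map; length; upTo; reverse)
open import Data.List.Relation.Binary.Permutation.Propositional using (_↭_)
open import Data.Product using (_×_; _,_)
open import Relation.Nullary using (yes; no)

IsPerm : List ℕ → Set
IsPerm π = π ↭ map suc (upTo (length π))

_⊕_ : List ℕ → List ℕ → List ℕ
σ ⊕ ρ = σ ++ map (λ x → x + length σ) ρ

-- Pop from the stack (top = head) while the top is the smallest value k
-- not yet output.  Returns the new "next value to output" and the stack.
popAll : ℕ → List ℕ → ℕ × List ℕ
popAll k [] = k , []
popAll k (y ∷ ys) with y ≟ k
... | yes _ = popAll (suc k) ys
... | no _  = k , y ∷ ys

pass : ℕ → List ℕ → List ℕ → ℕ × List ℕ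
pass k [] st = k , st
pass k (x ∷ xs) st with popAll k (x ∷ st)
... | k' , st' = pass k' xs st'

-- The leftover stack is
-- returned to the input in original relative order (= reverse of stack,
-- since the top is the head).  The fuel argument is never exhausted when
-- started with fuel = length of input, since every pass on a nonempty
-- input outputs at least the current smallest remaining value.
countPasses : ℕ → ℕ → List ℕ → ℕ
countPasses _ _ [] = 0
countPasses zero _ (_ ∷ _) = 0
countPasses (suc f) k (x ∷ xs) with pass k (x ∷ xs) []
... | k' , st = suc (countPasses f k' (reverse st))

passes : List ℕ → ℕ
passes π = countPasses (length π) 1 π

tier : List ℕ → ℕ
tier π = passes π ∸ 1

-- A pass over σ ⊕ ρ first behaves exactly like a pass over σ. If entries of σ
-- remain on the stack, the next value to output is one of them, buried under
-- everything pushed later; so no entry of the shifted ρ can be popped, all of ρ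
-- stays on the stack above σ's leftovers, and the next input is again
-- (leftover of σ) ++ (shifted ρ). Once a pass clears σ completely, the rest of
-- that pass is the first pass on ρ. Hence the two sorting processes share
-- exactly one pass: passes (σ ⊕ ρ) + 1 = passes σ + passes ρ.
module Submission where

open import Defs
open import Data.Nat using (ℕ; zero; suc; _+_; _∸_; _≤_; _<_; z≤n; s≤s)
open import Data.Nat.Properties
open import Algebra.Properties.CommutativeSemigroup +-commutativeSemigroup using (x∙yz≈y∙xz)
open import Data.List using (List; []; _∷_; _++_; _ʳ++_; map; length; reverse)
open import Data.List.Properties
  using (length-reverse; length-map; length-++; reverse-map; reverse-injective; ʳ++-ʳ++; ʳ++-defn; ++-identityʳ)
open import Data.List.Membership.Propositional using (_∈_)
open import Data.List.Membership.Propositional.Properties using (∈-map⁺; ∈-map⁻; ∈-upTo⁺)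
open import Data.List.Relation.Unary.Any using (here; there)
open import Data.List.Relation.Unary.Any.Properties using (reverse⁺)
open import Data.List.Relation.Unary.All as All using (All; []; _∷_)
open import Data.List.Relation.Unary.All.Properties using (map⁺)
open import Data.List.Relation.Binary.Permutation.Propositional using (↭-sym)
open import Data.List.Relation.Binary.Permutation.Propositional.Properties using (∈-resp-↭)
open import Data.Product using (_,_; proj₁; proj₂)
open import Data.Sum using (_⊎_; inj₁; inj₂)
open import Relation.Nullary using (yes; no; contradiction)
open import Function using (case_of_)
open import Relation.Binary.PropositionalEquality

popAll-count : ∀ k ys → proj₁ (popAll k ys) + length (proj₂ (popAll k ys)) ≡ k + length ys
popAll-count k [] = refl
popAll-count k (y ∷ ys) with y ≟ k
... | yes _ = trans (popAll-count (suc k) ys) (sym (+-suc k (length ys)))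
... | no _  = refl

popAll-next-≥ : ∀ k ys → k ≤ proj₁ (popAll k ys)
popAll-next-≥ k [] = ≤-refl
popAll-next-≥ k (y ∷ ys) with y ≟ k
... | yes _ = ≤-trans (n≤1+n k) (popAll-next-≥ (suc k) ys)
... | no _  = ≤-refl

popAll-keeps : ∀ k ys {j} → j ∈ ys → proj₁ (popAll k ys) ≤ j → j ∈ proj₂ (popAll k ys)
popAll-keeps k (y ∷ ys) j∈ k′≤j with y ≟ k
popAll-keeps k (y ∷ ys) (here refl) k′≤j | yes refl =
  contradiction (<-≤-trans (popAll-next-≥ (suc k) ys) k′≤j) (<-irrefl refl)
popAll-keeps k (y ∷ ys) (there j∈) k′≤j | yes refl = popAll-keeps (suc k) ys j∈ k′≤j
... | no _ = j∈

popAll-pops-head : ∀ k ys → k < proj₁ (popAll k (k ∷ ys))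
popAll-pops-head k ys with k ≟ k
... | yes _  = popAll-next-≥ (suc k) ys
... | no k≢k = contradiction refl k≢k

popAll-blocked : ∀ k y ys → y ≢ k → popAll k (y ∷ ys) ≡ (k , y ∷ ys)
popAll-blocked k y ys y≢k with y ≟ k
... | yes y≡k = contradiction y≡k y≢k
... | no _    = refl

popAll-shift : ∀ a k ys →
  popAll (k + a) (map (_+ a) ys) ≡ (proj₁ (popAll k ys) + a , map (_+ a) (proj₂ (popAll k ys)))
popAll-shift a k [] = refl
popAll-shift a k (y ∷ ys) with y ≟ k | y + a ≟ k + a
... | yes refl | yes _    = popAll-shift a (suc k) ys
... | yes refl | no k≢k   = contradiction refl k≢k
... | no y≢k   | yes y+≡k = contradiction (+-cancelʳ-≡ a y k y+≡k) y≢k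
... | no _     | no _     = refl

pass-count : ∀ k xs st → proj₁ (pass k xs st) + length (proj₂ (pass k xs st)) ≡ k + (length xs + length st)
pass-count k [] st = refl
pass-count k (x ∷ xs) st = begin
  proj₁ (pass k′ xs st′) + length (proj₂ (pass k′ xs st′)) ≡⟨ pass-count k′ xs st′ ⟩
  k′ + (length xs + length st′)                             ≡⟨ x∙yz≈y∙xz k′ (length xs) (length st′) ⟩
  length xs + (k′ + length st′)                             ≡⟨ cong (length xs +_) (popAll-count k (x ∷ st)) ⟩
  length xs + (k + suc (length st))                         ≡⟨ x∙yz≈y∙xz (length xs) k (suc (length st)) ⟩
  k + (length xs + suc (length st))                         ≡⟨ cong (k +_) (+-suc (length xs) (length st)) ⟩
  k + (suc (length xs) + length st)                         ∎
  where
  open ≡-Reasoning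
  k′ = proj₁ (popAll k (x ∷ st))
  st′ = proj₂ (popAll k (x ∷ st))

pass-next-≥ : ∀ k xs st → k ≤ proj₁ (pass k xs st)
pass-next-≥ k [] st = ≤-refl
pass-next-≥ k (x ∷ xs) st = ≤-trans (popAll-next-≥ k (x ∷ st)) (pass-next-≥ _ xs _)

pass-keeps : ∀ k xs st {j} → j ∈ xs ⊎ j ∈ st → proj₁ (pass k xs st) ≤ j → j ∈ proj₂ (pass k xs st)
pass-keeps k [] st (inj₂ j∈st) _ = j∈st
pass-keeps k (x ∷ xs) st (inj₁ (there j∈xs)) k′≤j = pass-keeps _ xs _ (inj₁ j∈xs) k′≤j
pass-keeps k (x ∷ xs) st (inj₁ (here j≡x)) k′≤j =
  pass-keeps _ xs _ (inj₂ (popAll-keeps k (x ∷ st) (here j≡x) (≤-trans (pass-next-≥ _ xs _) k′≤j))) k′≤j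
pass-keeps k (x ∷ xs) st (inj₂ j∈st) k′≤j =
  pass-keeps _ xs _ (inj₂ (popAll-keeps k (x ∷ st) (there j∈st) (≤-trans (pass-next-≥ _ xs _) k′≤j))) k′≤j

pass-outputs-∈ : ∀ {k} k₀ xs st → k ≤ k₀ → k ∈ xs → k < proj₁ (pass k₀ xs st)
pass-outputs-∈ {k} k₀ xs st k≤k₀ k∈ with m≤n⇒m<n∨m≡n k≤k₀
... | inj₁ k<k₀ = <-≤-trans k<k₀ (pass-next-≥ k₀ xs st)
pass-outputs-∈ k (x ∷ xs) st _ (here refl) | inj₂ refl = <-≤-trans (popAll-pops-head k st) (pass-next-≥ _ xs _)
pass-outputs-∈ k (x ∷ xs) st _ (there k∈) | inj₂ refl = pass-outputs-∈ _ xs _ (popAll-next-≥ k (x ∷ st)) k∈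

pass-++ : ∀ k xs ys st → pass k (xs ++ ys) st ≡ pass (proj₁ (pass k xs st)) ys (proj₂ (pass k xs st))
pass-++ k [] ys st = refl
pass-++ k (x ∷ xs) ys st = pass-++ _ xs ys _

pass-blocked : ∀ k ys st → All (_≢ k) ys → pass k ys st ≡ (k , ys ʳ++ st)
pass-blocked k [] st [] = refl
pass-blocked k (y ∷ ys) st (y≢k ∷ ys≢k) rewrite popAll-blocked k y st y≢k = pass-blocked k ys (y ∷ st) ys≢k

pass-shift : ∀ a k xs st →
  pass (k + a) (map (_+ a) xs) (map (_+ a) st) ≡ (proj₁ (pass k xs st) + a , map (_+ a) (proj₂ (pass k xs st)))
pass-shift a k [] st = refl
pass-shift a k (x ∷ xs) st =
  trans (cong (λ p → pass (proj₁ p) (map (_+ a) xs) (proj₂ p)) (popAll-shift a k (x ∷ st)))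
        (pass-shift a _ xs _)

countPasses-shift : ∀ f a k xs → countPasses f (k + a) (map (_+ a) xs) ≡ countPasses f k xs
countPasses-shift f a k [] = refl
countPasses-shift zero a k (x ∷ xs) = refl
countPasses-shift (suc f) a k (x ∷ xs) = cong suc (begin
  countPasses f (proj₁ p′) (reverse (proj₂ p′))           ≡⟨ cong (λ q → countPasses f (proj₁ q) (reverse (proj₂ q))) (pass-shift a k (x ∷ xs) []) ⟩
  countPasses f (proj₁ p + a) (reverse (map (_+ a) (proj₂ p))) ≡⟨ cong (countPasses f (proj₁ p + a)) (sym (reverse-map (_+ a) (proj₂ p))) ⟩
  countPasses f (proj₁ p + a) (map (_+ a) (reverse (proj₂ p))) ≡⟨ countPasses-shift f a (proj₁ p) (reverse (proj₂ p)) ⟩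
  countPasses f (proj₁ p) (reverse (proj₂ p))             ∎)
  where
  open ≡-Reasoning
  p = pass k (x ∷ xs) []
  p′ = pass (k + a) (map (_+ a) (x ∷ xs)) []

-- The input of a pass when k is the next value to output and n is the largest
-- value (a permutation of k, …, n, recorded by its length and coverage).
record Remaining (k n : ℕ) (xs : List ℕ) : Set where
  field
    size     : length xs + k ≡ suc n
    complete : ∀ {j} → k ≤ j → j ≤ n → j ∈ xs

open Remaining

next : ℕ → List ℕ → ℕ
next k xs = proj₁ (pass k xs [])

leftover : ℕ → List ℕ → List ℕ
leftover k xs = reverse (proj₂ (pass k xs []))

Remaining-≤ : ∀ {k n xs} → Remaining k n xs → xs ≢ [] → k ≤ n
Remaining-≤ {xs = []} _ xs≢[] = contradiction refl xs≢[]
Remaining-≤ {k} {xs = x ∷ xs} R _ = ≤-pred (subst (k <_) (size R) (s≤s (m≤n+m k (length xs))))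

Remaining-pass : ∀ {k n xs} → Remaining k n xs → Remaining (next k xs) n (leftover k xs)
size (Remaining-pass {k} {n} {xs} R) = begin
  length (leftover k xs) + next k xs              ≡⟨ cong (_+ next k xs) (length-reverse (proj₂ (pass k xs []))) ⟩
  length (proj₂ (pass k xs [])) + next k xs       ≡⟨ +-comm _ (next k xs) ⟩
  next k xs + length (proj₂ (pass k xs []))       ≡⟨ pass-count k xs [] ⟩
  k + (length xs + 0)                             ≡⟨ cong (k +_) (+-identityʳ (length xs)) ⟩
  k + length xs                                   ≡⟨ +-comm k (length xs) ⟩
  length xs + k                                   ≡⟨ size R ⟩
  suc n                                           ∎
  where open ≡-Reasoning
complete (Remaining-pass {k} {xs = xs} R) k′≤j j≤n =
  reverse⁺ (pass-keeps k xs [] (inj₁ (complete R (≤-trans (pass-next-≥ k xs []) k′≤j) j≤n)) k′≤j)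

leftover-shorter : ∀ {k n xs} → Remaining k n xs → xs ≢ [] → length (leftover k xs) < length xs
leftover-shorter {k} {xs = xs} R xs≢[] = +-cancelˡ-< k _ _ (begin-strict
  k + length (leftover k xs)                    ≡⟨ cong (k +_) (length-reverse (proj₂ (pass k xs []))) ⟩
  k + length (proj₂ (pass k xs []))             <⟨ +-monoˡ-< _ k<next ⟩
  next k xs + length (proj₂ (pass k xs []))     ≡⟨ pass-count k xs [] ⟩
  k + (length xs + 0)                           ≡⟨ cong (k +_) (+-identityʳ (length xs)) ⟩
  k + length xs                                 ∎)
  where
  open ≤-Reasoning
  k<next : k < next k xs
  k<next = pass-outputs-∈ k xs [] ≤-refl (complete R ≤-refl (Remaining-≤ R xs≢[]))

countPasses-fuel : ∀ f g {k n} xs → Remaining k n xs → length xs ≤ f → length xs ≤ g →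
  countPasses f k xs ≡ countPasses g k xs
countPasses-fuel f g [] _ _ _ = refl
countPasses-fuel (suc f) (suc g) {k} (x ∷ xs) R xs≤f xs≤g =
  cong suc (countPasses-fuel f g (leftover k (x ∷ xs)) (Remaining-pass R)
    (≤-pred (≤-trans shorter xs≤f)) (≤-pred (≤-trans shorter xs≤g)))
  where
  shorter = leftover-shorter R (λ ())

reverse-ʳ++ : ∀ (xs ys : List ℕ) → reverse (xs ʳ++ ys) ≡ reverse ys ++ xs
reverse-ʳ++ xs ys = trans (ʳ++-ʳ++ xs) (trans (cong (ys ʳ++_) (++-identityʳ xs)) (ʳ++-defn ys))

reverse-∷≢[] : ∀ {x : ℕ} xs → reverse (x ∷ xs) ≢ []
reverse-∷≢[] {x} xs rev≡[] with reverse-injective {x = x ∷ xs} {y = []} rev≡[]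
... | ()

pass-blocked-above : ∀ {k a} st ys → k ≤ a → All (a <_) ys → pass k ys st ≡ (k , ys ʳ++ st)
pass-blocked-above {k} {a} st ys k≤a a<ys =
  pass-blocked k ys st (All.map (λ a<y y≡k → <⇒≱ a<y (subst (_≤ a) (sym y≡k) k≤a)) a<ys)

countPasses-++ : ∀ f g {k a n} L y M → Remaining k a L → L ≢ [] →
  Remaining (suc a) n (y ∷ M) → All (a <_) (y ∷ M) → length L ≤ f → length (y ∷ M) ≤ g →
  suc (countPasses (f + g) k (L ++ y ∷ M)) ≡ countPasses f k L + countPasses g (suc a) (y ∷ M)
countPasses-++ f g [] y M _ L≢[] _ _ _ _ = contradiction refl L≢[]
countPasses-++ (suc f) (suc g) {k} {a} (x ∷ L) y M RL _ RM a<M L≤f M≤g = begin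
  suc (countPasses (suc f + suc g) k (x ∷ L ++ y ∷ M))
    ≡⟨ cong (λ p → suc (suc (countPasses (f + suc g) (proj₁ p) (reverse (proj₂ p))))) (pass-++ k (x ∷ L) (y ∷ M) []) ⟩
  suc (suc (countPasses (f + suc g) (proj₁ (pass kL (y ∷ M) stL)) (reverse (proj₂ (pass kL (y ∷ M) stL)))))
    ≡⟨ after-L kL stL (Remaining-pass RL) (≤-pred (≤-trans (leftover-shorter RL (λ ())) L≤f)) ⟩
  suc (countPasses f kL (reverse stL)) + countPasses (suc g) (suc a) (y ∷ M)
    ∎
  where
  open ≡-Reasoning
  kL = next k (x ∷ L)
  stL = proj₂ (pass k (x ∷ L) [])
  after-L : ∀ kL stL → Remaining kL a (reverse stL) → length (reverse stL) ≤ f →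
    suc (suc (countPasses (f + suc g) (proj₁ (pass kL (y ∷ M) stL)) (reverse (proj₂ (pass kL (y ∷ M) stL)))))
      ≡ suc (countPasses f kL (reverse stL)) + countPasses (suc g) (suc a) (y ∷ M)
  after-L kL [] R _ with size R
  ... | refl = cong (λ c → suc (suc c))
    (countPasses-fuel (f + suc g) g (leftover (suc a) (y ∷ M)) (Remaining-pass RM)
      (≤-trans leftover≤g (≤-trans (n≤1+n g) (m≤n+m (suc g) f))) leftover≤g)
    where
    leftover≤g : length (leftover (suc a) (y ∷ M)) ≤ g
    leftover≤g = ≤-pred (≤-trans (leftover-shorter RM (λ ())) M≤g)
  after-L kL st@(_ ∷ ss) R st≤f = begin
    suc (suc (countPasses (f + suc g) (proj₁ (pass kL (y ∷ M) st)) (reverse (proj₂ (pass kL (y ∷ M) st)))))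
      ≡⟨ cong (λ p → suc (suc (countPasses (f + suc g) (proj₁ p) (reverse (proj₂ p)))))
           (pass-blocked-above st (y ∷ M) (Remaining-≤ R (reverse-∷≢[] ss)) a<M) ⟩
    suc (suc (countPasses (f + suc g) kL (reverse ((y ∷ M) ʳ++ st))))
      ≡⟨ cong (λ l → suc (suc (countPasses (f + suc g) kL l))) (reverse-ʳ++ (y ∷ M) st) ⟩
    suc (suc (countPasses (f + suc g) kL (reverse st ++ y ∷ M)))
      ≡⟨ cong suc (countPasses-++ f (suc g) (reverse st) y M R (reverse-∷≢[] ss) RM a<M st≤f M≤g) ⟩
    suc (countPasses f kL (reverse st) + countPasses (suc g) (suc a) (y ∷ M))
      ∎

IsPerm⇒Remaining : ∀ {σ} → IsPerm σ → Remaining 1 (length σ) σ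
size (IsPerm⇒Remaining {σ} _) = +-comm (length σ) 1
complete (IsPerm⇒Remaining σ-perm) {suc j} _ j≤n = ∈-resp-↭ (↭-sym σ-perm) (∈-map⁺ suc (∈-upTo⁺ j≤n))

IsPerm⇒positive : ∀ {σ} → IsPerm σ → All (0 <_) σ
IsPerm⇒positive σ-perm = All.tabulate λ x∈σ → case ∈-map⁻ suc (∈-resp-↭ σ-perm x∈σ) of λ where
  (_ , _ , refl) → s≤s z≤n

Remaining-shift : ∀ a {k n xs} → Remaining k n xs → Remaining (k + a) (n + a) (map (_+ a) xs)
size (Remaining-shift a {k} {n} {xs} R) = begin
  length (map (_+ a) xs) + (k + a) ≡⟨ cong (_+ (k + a)) (length-map (_+ a) xs) ⟩
  length xs + (k + a)              ≡⟨ +-assoc (length xs) k a ⟨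
  length xs + k + a                ≡⟨ cong (_+ a) (size R) ⟩
  suc n + a                        ∎
  where open ≡-Reasoning
complete (Remaining-shift a {k} {n} {xs} R) {j} k+a≤j j≤n+a =
  subst (_∈ map (_+ a) xs) (m∸n+n≡m a≤j)
    (∈-map⁺ (_+ a) (complete R (m+n≤o⇒m≤o∸n k k+a≤j) (subst (j ∸ a ≤_) (m+n∸n≡m n a) (∸-monoˡ-≤ a j≤n+a))))
  where
  a≤j : a ≤ j
  a≤j = ≤-trans (m≤n+m a k) k+a≤j

length-⊕ : ∀ σ ρ → length (σ ⊕ ρ) ≡ length σ + length ρ
length-⊕ σ ρ = trans (length-++ σ) (cong (length σ +_) (length-map (_+ length σ) ρ))

passes-⊕ : ∀ σ ρ → IsPerm σ → IsPerm ρ → σ ≢ [] → ρ ≢ [] → suc (passes (σ ⊕ ρ)) ≡ passes σ + passes ρ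
passes-⊕ σ [] _ _ _ ρ≢[] = contradiction refl ρ≢[]
passes-⊕ σ ρ@(r ∷ ρ′) σ-perm ρ-perm σ≢[] _ = begin
  suc (countPasses (length (σ ⊕ ρ)) 1 (σ ⊕ ρ))    ≡⟨ cong (λ f → suc (countPasses f 1 (σ ⊕ ρ))) (length-⊕ σ ρ) ⟩
  suc (countPasses (a + length ρ) 1 (σ ⊕ ρ))      ≡⟨ countPasses-++ a (length ρ) σ (r + a) (map (_+ a) ρ′)
                                                       (IsPerm⇒Remaining σ-perm) σ≢[]
                                                       (Remaining-shift a (IsPerm⇒Remaining ρ-perm))
                                                       (map⁺ (All.map (+-monoˡ-< a) (IsPerm⇒positive ρ-perm)))
                                                       ≤-refl (≤-reflexive (length-map (_+ a) ρ)) ⟩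
  passes σ + countPasses (length ρ) (1 + a) (map (_+ a) ρ) ≡⟨ cong (passes σ +_) (countPasses-shift (length ρ) a 1 ρ) ⟩
  passes σ + passes ρ                              ∎
  where
  open ≡-Reasoning
  a = length σ

proposition3p19 : (σ ρ : List ℕ) → IsPerm σ → IsPerm ρ → σ ≢ [] → ρ ≢ [] →
    tier (σ ⊕ ρ) ≡ tier σ + tier ρ
proposition3p19 [] _ _ _ σ≢[] _ = contradiction refl σ≢[]
proposition3p19 _ [] _ _ _ ρ≢[] = contradiction refl ρ≢[]
proposition3p19 σ@(_ ∷ _) ρ@(_ ∷ _) σ-perm ρ-perm σ≢[] ρ≢[] =
  suc-injective (trans (suc-injective (passes-⊕ σ ρ σ-perm ρ-perm σ≢[] ρ≢[])) (+-suc (tier σ) (tier ρ)))
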